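{- Let $\mathbf A$ be a finite Boolean algebra and $P$ a conditional probability on $A\times A'$. If $t,t'\in\mathbb{T}(A)$ satisfy $\mathbf b(t)=\mathbf b(t')$ and $t^w=t'^w$ for every $w\in\Omega$ with $w\models\mathbf b(t)$, then $X_t=X_{t'}$.
   Context: $\mathbf A=(A,\wedge,\vee,\neg,\bot,\top)$ is a finite Boolean algebra; write $ab$ for $a\wedge b$, $\bar a$ for $\neg a$, and $A'=A\setminus\{\bot\}$. $\Omega$ is the set of Boolean homomorphisms $w:\mathbf A\to\{0,1\}$ (identified with atoms); $w\models a$ means $w(a)=1$. A basic conditional is a pair $(a\mid b)$, $a\in A$, $b\in A'$. $\mathbb{T}(A)$ is the set of terms built from basic conditionals (as variables) and constants $0,1$ using $\neg,\wedge,\vee$. $\mathbf b(t)$ is the disjunction of the antecedents of the basic conditionals occurring in $t$ ($\top$ if $t\in\{0,1\}$). The $w$-reduct $t^w$ is obtained by replacing each occurring $(a_i\mid b_i)$ by $1$ if $w\models a_ib_i$, by $0$ if $w\models\bar a_ib_i$ (unchanged if $w\models\bar b_i$), then applying $\neg1:=0$, $\neg0:=1$, $r\wedge1=1\wedge r:=r$, $r\wedge0=0\wedge r:=0$, $r\vee1=1\vee r:=1$, $r\vee0=0\vee r:=r$ to subterms until no rule applies. A conditional probability on $A\times A'$ is $P:A\times A'\to[0,1]$ with $P(\cdot\mid b)$ a finitely additive probability for each $b\in A'$, $P(b\mid b)=1$, $P(ab\mid c)=P(a\mid bc)P(b\mid c)$. $\mathbb P(X\mid b)=\sum_wX(w)P(w\mid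 b)$. Given $P$, $X_t:\Omega\to[0,1]$ is defined recursively by $X_1\equiv1$, $X_0\equiv0$, $X_t(w)=\mathbb P(X_{t^w}\mid\mathbf b(t^w))$; for $w\models\neg\mathbf b(t)$, $t^w=t$ and $X_t(w)=\mathbb P(X_t\mid\mathbf b(t))$, which depends only on $X_t$ at worlds satisfying $\mathbf b(t)$. -}

module Defs where

open import Level using (Level; _⊔_)
open import Data.Bool using (Bool; true; false; if_then_else_; T; _∨_)
open import Data.Nat using (ℕ; zero; suc) renaming (_+_ to _+ℕ_)
open import Data.Fin using (Fin; zero; suc)
open import Data.Vec using (lookup)
open import Data.Fin.Subset using (Subset; ⊤; ⊥; ⁅_⁆; _∪_; _∩_; Nonempty; Empty)
open import Data.Fin.Subset.Properties using (nonempty?)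
open import Relation.Nullary.Decidable using (isYes)
open import Relation.Binary.Core using (Rel)
open import Algebra.Bundles using (CommutativeSemiring)

-- The finite Boolean algebra A is (up to isomorphism) the powerset of
-- its set of atoms Fin n:  A = Subset n.  Worlds w ∈ Ω are identified
-- with atoms, i.e. w : Fin n, and  w ⊨ a  iff  lookup a w ≡ true.

_⊨_ : ∀ {n} → Fin n → Subset n → Set
w ⊨ a = T (lookup a w)

-- Boolean test for b ∈ A' (b ≠ ⊥); T of it is proof-irrelevant.
nonemptyᵇ : ∀ {n} → Subset n → Bool
nonemptyᵇ b = isYes (nonempty? b)

data Term (n : ℕ) : Set where
  cnd  : (a b : Subset n) → T (nonemptyᵇ b) → Term n
  𝟘 𝟙  : Term n
  ¬ᵗ_  : Term n → Term n
  _∧ᵗ_ : Term n → Term n → Term n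
  _∨ᵗ_ : Term n → Term n → Term n

hasCond : ∀ {n} → Term n → Bool
hasCond (cnd a b _) = true
hasCond 𝟘 = false
hasCond 𝟙 = false
hasCond (¬ᵗ t) = hasCond t
hasCond (t ∧ᵗ s) = hasCond t ∨ hasCond s
hasCond (t ∨ᵗ s) = hasCond t ∨ hasCond s

joinAnts : ∀ {n} → Term n → Subset n
joinAnts (cnd a b _) = b
joinAnts 𝟘 = ⊥
joinAnts 𝟙 = ⊥
joinAnts (¬ᵗ t) = joinAnts t
joinAnts (t ∧ᵗ s) = joinAnts t ∪ joinAnts s
joinAnts (t ∨ᵗ s) = joinAnts t ∪ joinAnts s

𝐛 : ∀ {n} → Term n → Subset n
𝐛 t = if hasCond t then joinAnts t else ⊤

-- The w-reduct t^w: substitute, then simplify with the rules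
-- ¬1=0, ¬0=1, r∧1=1∧r=r, r∧0=0∧r=0, r∨1=1∨r=1, r∨0=0∨r=r
-- (bottom-up, which yields the normal form).

neg : ∀ {n} → Term n → Term n
neg 𝟙 = 𝟘
neg 𝟘 = 𝟙
neg r = ¬ᵗ r

conj : ∀ {n} → Term n → Term n → Term n
conj 𝟘 r = 𝟘
conj 𝟙 r = r
conj r 𝟘 = 𝟘
conj r 𝟙 = r
conj r s = r ∧ᵗ s

disj : ∀ {n} → Term n → Term n → Term n
disj 𝟙 r = 𝟙
disj 𝟘 r = r
disj r 𝟙 = 𝟙
disj r 𝟘 = r
disj r s = r ∨ᵗ s

reduct : ∀ {n} → Fin n → Term n → Term n
reduct w (cnd a b p) =
  if lookup b w then (if lookup a w then 𝟙 else 𝟘) else cnd a b p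
reduct w 𝟘 = 𝟘
reduct w 𝟙 = 𝟙
reduct w (¬ᵗ t) = neg (reduct w t)
reduct w (t ∧ᵗ s) = conj (reduct w t) (reduct w s)
reduct w (t ∨ᵗ s) = disj (reduct w t) (reduct w s)

-- For non-constant t and w ⊨ 𝐛(t) it strictly decreases under reduct,
-- so it bounds the recursion depth in the definition of X_t.
μ : ∀ {n} → Term n → ℕ
μ (cnd a b _) = 2
μ 𝟘 = 1
μ 𝟙 = 1
μ (¬ᵗ t) = suc (μ t)
μ (t ∧ᵗ s) = suc (μ t +ℕ μ s)
μ (t ∨ᵗ s) = suc (μ t +ℕ μ s)

-- Scalars: an arbitrary commutative semiring R (e.g. ℝ) with an order
-- relation _≤_ used only to express that values lie in [0,1].

module _ {c ℓ ℓ'} (R : CommutativeSemiring c ℓ)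
         (_≤_ : Rel (CommutativeSemiring.Carrier R) ℓ') where

  open CommutativeSemiring R using (Carrier; _≈_; _+_; _*_; 0#; 1#)

  Σ : ∀ {n} → (Fin n → Carrier) → Carrier
  Σ {zero} f = 0#
  Σ {suc n} f = f zero + Σ (λ i → f (suc i))

  record CondProb (n : ℕ) : Set (c ⊔ ℓ ⊔ ℓ') where
    field
      P        : Subset n → Subset n → Carrier
      nonneg   : ∀ a b → Nonempty b → 0# ≤ P a b
      le-one   : ∀ a b → Nonempty b → P a b ≤ 1#
      normed   : ∀ b → Nonempty b → P ⊤ b ≈ 1#
      additive : ∀ a a' b → Nonempty b → Empty (a ∩ a') →
                 P (a ∪ a') b ≈ P a b + P a' b
      self     : ∀ b → Nonempty b → P b b ≈ 1#
      chain    : ∀ a b c → Nonempty (b ∩ c) →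
                 P (a ∩ b) c ≈ P a (b ∩ c) * P b c

  module _ {n : ℕ} (Pr : CondProb n) where
    open CondProb Pr

    𝔼 : (Fin n → Carrier) → Subset n → Carrier
    𝔼 X b = Σ (λ v → X v * P ⁅ v ⁆ b)

    Xf : ℕ → Term n → Fin n → Carrier
    inner : ℕ → Term n → Fin n → Carrier

    Xf k 𝟙 w = 1#
    Xf k 𝟘 w = 0#
    Xf zero t w = 0#
    Xf (suc k) t w =
      if lookup (𝐛 t) w
      then inner k t w
      -- w ⊨ ¬𝐛(t): X_t(w) = ℙ(X_t ∣ 𝐛(t)), using only values on 𝐛(t)
      else Σ (λ v → (if lookup (𝐛 t) v then inner k t v else 0#)
                     * P ⁅ v ⁆ (𝐛 t))

    inner k t v = 𝔼 (Xf k (reduct v t)) (𝐛 (reduct v t))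

    X : Term n → Fin n → Carrier
    X t = Xf (μ t) t

-- Unfolding the definition of X once gives, for every term t,
--   X_t(w) = ℙ(X_{t^w} ∣ 𝐛(t^w))  if w ⊨ 𝐛(t),     X_t(w) = ℙ(X_t·1_{𝐛(t)} ∣ 𝐛(t))  otherwise,
-- so X_t is determined by 𝐛(t) and the map w ↦ t^w on the worlds of 𝐛(t), which are
-- exactly the data the hypotheses identify for t and t′.  For the constants the
-- unfolding reads 0 = ℙ(0 ∣ ⊤) and 1 = ℙ(1 ∣ ⊤), the latter by total probability over
-- the atoms.  The fuel μ(t) in the definition of X is irrelevant because μ decreases
-- strictly from t to t^w whenever w ⊨ 𝐛(t).

module Submission where

open import Defs
open import Algebra.Bundles using (CommutativeSemiring)
open import Data.Bool using (true; false; T; if_then_else_)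
open import Data.Bool.Properties using (T-∨; T-≡; ∨-conicalˡ; ∨-conicalʳ)
open import Data.Empty using (⊥-elim)
open import Data.Fin using (Fin; zero; suc)
open import Data.Fin.Properties using (suc-injective)
open import Data.Fin.Subset using (Subset; ⊤; ⊥; ⁅_⁆; _∪_; _∩_; _∈_; Nonempty; Empty)
open import Data.Fin.Subset.Properties
  using (x∈⁅x⁆; x∈⁅y⁆⇒x≡y; x∈p∪q⁺; x∈p∪q⁻; x∈p∩q⁺; x∈p∩q⁻; ∈⊤; ⊆⊤; ⊆-antisym)
open import Data.Nat as ℕ using (ℕ; zero; suc; _≤_; _<_; z≤n; s≤s)
open import Data.Nat.Properties
  using ( ≤-refl; ≤-trans; ≤-<-trans; <-≤-trans; ≤-pred; n≮0; n≤1+n; m≤m+n; m≤n+m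
        ; m≤n⇒m≤1+n; +-mono-≤; +-mono-<-≤; +-mono-≤-<)
open import Data.Product using (∃; _,_)
open import Data.Sum using (_⊎_; inj₁; inj₂)
open import Data.Vec using (lookup)
open import Data.Vec.Properties using (lookup-replicate; lookup-zipWith)
open import Function using (_∘_; Equivalence)
open import Relation.Binary.Core using (Rel)
open import Relation.Binary.PropositionalEquality as ≡ using (_≡_; _≢_)
open import Relation.Nullary using (¬_)

private variable
  n : ℕ
  a b : Subset n
  w : Fin n

⊨⊤ : (w : Fin n) → w ⊨ ⊤
⊨⊤ w = Equivalence.from T-≡ (lookup-replicate w true)

⊭⊥ : (w : Fin n) → ¬ (w ⊨ ⊥)
⊭⊥ w h = ≡.subst T (lookup-replicate w false) h

⊨-∪⁻ : w ⊨ (a ∪ b) → w ⊨ a ⊎ w ⊨ b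
⊨-∪⁻ {w = w} {a} {b} h = Equivalence.to T-∨ (≡.subst T (lookup-zipWith _ w a b) h)

⋃ᶠ : ∀ {n k} → (Fin (suc k) → Subset n) → Subset n
⋃ᶠ {k = zero}  A = A zero
⋃ᶠ {k = suc k} A = A zero ∪ ⋃ᶠ (A ∘ suc)

x∈⋃ᶠ⁺ : ∀ {n k} (A : Fin (suc k) → Subset n) {x} i → x ∈ A i → x ∈ ⋃ᶠ A
x∈⋃ᶠ⁺ {k = zero}  A zero    h = h
x∈⋃ᶠ⁺ {k = suc k} A zero    h = x∈p∪q⁺ (inj₁ h)
x∈⋃ᶠ⁺ {k = suc k} A (suc i) h = x∈p∪q⁺ {p = A zero} (inj₂ (x∈⋃ᶠ⁺ (A ∘ suc) i h))

x∈⋃ᶠ⁻ : ∀ {n k} (A : Fin (suc k) → Subset n) {x} → x ∈ ⋃ᶠ A → ∃ λ i → x ∈ A i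
x∈⋃ᶠ⁻ {k = zero}  A h = zero , h
x∈⋃ᶠ⁻ {k = suc k} A h with x∈p∪q⁻ (A zero) (⋃ᶠ (A ∘ suc)) h
... | inj₁ h₀ = zero , h₀
... | inj₂ h₁ with x∈⋃ᶠ⁻ (A ∘ suc) h₁
...   | i , hᵢ = suc i , hᵢ

⋃ᶠ-atoms : ∀ {m} → ⋃ᶠ (⁅_⁆ {suc m}) ≡ ⊤
⋃ᶠ-atoms = ⊆-antisym ⊆⊤ (λ {x} _ → x∈⋃ᶠ⁺ ⁅_⁆ x (x∈⁅x⁆ x))

atoms-disjoint : ∀ {n} {i j : Fin n} → i ≢ j → Empty (⁅ i ⁆ ∩ ⁅ j ⁆)
atoms-disjoint {i = i} {j} i≢j (x , h) with x∈p∩q⁻ ⁅ i ⁆ ⁅ j ⁆ h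
... | hᵢ , hⱼ = i≢j (≡.trans (≡.sym (x∈⁅y⁆⇒x≡y i hᵢ)) (x∈⁅y⁆⇒x≡y j hⱼ))

data Constant : Term n → Set where
  𝟘 : Constant {n} 𝟘
  𝟙 : Constant {n} 𝟙

data Compound : Term n → Set where
  cnd  : ∀ a b p → Compound {n} (cnd a b p)
  ¬ᵗ_  : ∀ t → Compound {n} (¬ᵗ t)
  _∧ᵗ_ : ∀ t s → Compound {n} (t ∧ᵗ s)
  _∨ᵗ_ : ∀ t s → Compound {n} (t ∨ᵗ s)

constant-or-compound : (t : Term n) → Constant t ⊎ Compound t
constant-or-compound (cnd a b p) = inj₂ (cnd a b p)
constant-or-compound 𝟘 = inj₁ 𝟘
constant-or-compound 𝟙 = inj₁ 𝟙
constant-or-compound (¬ᵗ t) = inj₂ (¬ᵗ t)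
constant-or-compound (t ∧ᵗ s) = inj₂ (t ∧ᵗ s)
constant-or-compound (t ∨ᵗ s) = inj₂ (t ∨ᵗ s)

μ-positive : (t : Term n) → 0 < μ t
μ-positive (cnd a b p) = s≤s z≤n
μ-positive 𝟘 = s≤s z≤n
μ-positive 𝟙 = s≤s z≤n
μ-positive (¬ᵗ t) = s≤s z≤n
μ-positive (t ∧ᵗ s) = s≤s z≤n
μ-positive (t ∨ᵗ s) = s≤s z≤n

μ-compound : {t : Term n} → Compound t → 1 < μ t
μ-compound (cnd a b p) = ≤-refl
μ-compound (¬ᵗ t) = s≤s (μ-positive t)
μ-compound (t ∧ᵗ s) = s≤s (≤-trans (μ-positive t) (m≤m+n _ _))
μ-compound (t ∨ᵗ s) = s≤s (≤-trans (μ-positive t) (m≤m+n _ _))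

μ-constant : {t : Term n} → Constant t → μ t ≡ 1
μ-constant 𝟘 = ≡.refl
μ-constant 𝟙 = ≡.refl

μ-neg : (r : Term n) → μ (neg r) ≤ μ (¬ᵗ r)
μ-neg (cnd a b p) = ≤-refl
μ-neg 𝟘 = s≤s z≤n
μ-neg 𝟙 = s≤s z≤n
μ-neg (¬ᵗ r) = ≤-refl
μ-neg (r ∧ᵗ s) = ≤-refl
μ-neg (r ∨ᵗ s) = ≤-refl

μ-subtermˡ : (r s : Term n) → μ r ≤ suc (μ r ℕ.+ μ s)
μ-subtermˡ r s = m≤n⇒m≤1+n (m≤m+n (μ r) (μ s))

μ-subtermʳ : (r s : Term n) → μ s ≤ suc (μ r ℕ.+ μ s)
μ-subtermʳ r s = m≤n⇒m≤1+n (m≤n+m (μ s) (μ r))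

μ-conj : (r s : Term n) → μ (conj r s) ≤ μ (r ∧ᵗ s)
μ-conj 𝟘 s = s≤s z≤n
μ-conj 𝟙 s = μ-subtermʳ 𝟙 s
μ-conj (cnd _ _ _) 𝟘 = s≤s z≤n
μ-conj r@(cnd _ _ _) 𝟙 = μ-subtermˡ r 𝟙
μ-conj (cnd _ _ _) (cnd _ _ _) = ≤-refl
μ-conj (cnd _ _ _) (¬ᵗ _) = ≤-refl
μ-conj (cnd _ _ _) (_ ∧ᵗ _) = ≤-refl
μ-conj (cnd _ _ _) (_ ∨ᵗ _) = ≤-refl
μ-conj (¬ᵗ _) 𝟘 = s≤s z≤n
μ-conj r@(¬ᵗ _) 𝟙 = μ-subtermˡ r 𝟙
μ-conj (¬ᵗ _) (cnd _ _ _) = ≤-refl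
μ-conj (¬ᵗ _) (¬ᵗ _) = ≤-refl
μ-conj (¬ᵗ _) (_ ∧ᵗ _) = ≤-refl
μ-conj (¬ᵗ _) (_ ∨ᵗ _) = ≤-refl
μ-conj (_ ∧ᵗ _) 𝟘 = s≤s z≤n
μ-conj r@(_ ∧ᵗ _) 𝟙 = μ-subtermˡ r 𝟙
μ-conj (_ ∧ᵗ _) (cnd _ _ _) = ≤-refl
μ-conj (_ ∧ᵗ _) (¬ᵗ _) = ≤-refl
μ-conj (_ ∧ᵗ _) (_ ∧ᵗ _) = ≤-refl
μ-conj (_ ∧ᵗ _) (_ ∨ᵗ _) = ≤-refl
μ-conj (_ ∨ᵗ _) 𝟘 = s≤s z≤n
μ-conj r@(_ ∨ᵗ _) 𝟙 = μ-subtermˡ r 𝟙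
μ-conj (_ ∨ᵗ _) (cnd _ _ _) = ≤-refl
μ-conj (_ ∨ᵗ _) (¬ᵗ _) = ≤-refl
μ-conj (_ ∨ᵗ _) (_ ∧ᵗ _) = ≤-refl
μ-conj (_ ∨ᵗ _) (_ ∨ᵗ _) = ≤-refl

μ-disj : (r s : Term n) → μ (disj r s) ≤ μ (r ∨ᵗ s)
μ-disj 𝟙 s = s≤s z≤n
μ-disj 𝟘 s = μ-subtermʳ 𝟘 s
μ-disj (cnd _ _ _) 𝟙 = s≤s z≤n
μ-disj r@(cnd _ _ _) 𝟘 = μ-subtermˡ r 𝟘
μ-disj (cnd _ _ _) (cnd _ _ _) = ≤-refl
μ-disj (cnd _ _ _) (¬ᵗ _) = ≤-refl
μ-disj (cnd _ _ _) (_ ∧ᵗ _) = ≤-refl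
μ-disj (cnd _ _ _) (_ ∨ᵗ _) = ≤-refl
μ-disj (¬ᵗ _) 𝟙 = s≤s z≤n
μ-disj r@(¬ᵗ _) 𝟘 = μ-subtermˡ r 𝟘
μ-disj (¬ᵗ _) (cnd _ _ _) = ≤-refl
μ-disj (¬ᵗ _) (¬ᵗ _) = ≤-refl
μ-disj (¬ᵗ _) (_ ∧ᵗ _) = ≤-refl
μ-disj (¬ᵗ _) (_ ∨ᵗ _) = ≤-refl
μ-disj (_ ∧ᵗ _) 𝟙 = s≤s z≤n
μ-disj r@(_ ∧ᵗ _) 𝟘 = μ-subtermˡ r 𝟘
μ-disj (_ ∧ᵗ _) (cnd _ _ _) = ≤-refl
μ-disj (_ ∧ᵗ _) (¬ᵗ _) = ≤-refl
μ-disj (_ ∧ᵗ _) (_ ∧ᵗ _) = ≤-refl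
μ-disj (_ ∧ᵗ _) (_ ∨ᵗ _) = ≤-refl
μ-disj (_ ∨ᵗ _) 𝟙 = s≤s z≤n
μ-disj r@(_ ∨ᵗ _) 𝟘 = μ-subtermˡ r 𝟘
μ-disj (_ ∨ᵗ _) (cnd _ _ _) = ≤-refl
μ-disj (_ ∨ᵗ _) (¬ᵗ _) = ≤-refl
μ-disj (_ ∨ᵗ _) (_ ∧ᵗ _) = ≤-refl
μ-disj (_ ∨ᵗ _) (_ ∨ᵗ _) = ≤-refl

μ-reduct<-cnd : ∀ (a b : Subset n) p → w ⊨ b → μ (reduct w (cnd a b p)) < μ (cnd a b p)
μ-reduct<-cnd {w = w} a b p h with lookup b w | lookup a w
... | true | true = ≤-refl
... | true | false = ≤-refl

μ-reduct≤ : (w : Fin n) (t : Term n) → μ (reduct w t) ≤ μ t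
μ-reduct≤ w (cnd a b p) with lookup b w | lookup a w
... | true | true = s≤s z≤n
... | true | false = s≤s z≤n
... | false | _ = ≤-refl
μ-reduct≤ w 𝟘 = ≤-refl
μ-reduct≤ w 𝟙 = ≤-refl
μ-reduct≤ w (¬ᵗ t) = ≤-trans (μ-neg _) (s≤s (μ-reduct≤ w t))
μ-reduct≤ w (t ∧ᵗ s) =
  ≤-trans (μ-conj (reduct w t) (reduct w s)) (s≤s (+-mono-≤ (μ-reduct≤ w t) (μ-reduct≤ w s)))
μ-reduct≤ w (t ∨ᵗ s) =
  ≤-trans (μ-disj (reduct w t) (reduct w s)) (s≤s (+-mono-≤ (μ-reduct≤ w t) (μ-reduct≤ w s)))

μ-reduct<-joinAnts : (t : Term n) → w ⊨ joinAnts t → μ (reduct w t) < μ t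
μ-reduct<-joinAnts (cnd a b p) h = μ-reduct<-cnd a b p h
μ-reduct<-joinAnts {w = w} 𝟘 h = ⊥-elim (⊭⊥ w h)
μ-reduct<-joinAnts {w = w} 𝟙 h = ⊥-elim (⊭⊥ w h)
μ-reduct<-joinAnts (¬ᵗ t) h = ≤-<-trans (μ-neg _) (s≤s (μ-reduct<-joinAnts t h))
μ-reduct<-joinAnts {w = w} (t ∧ᵗ s) h with ⊨-∪⁻ {a = joinAnts t} h
... | inj₁ h =
  ≤-<-trans (μ-conj (reduct w t) (reduct w s)) (s≤s (+-mono-<-≤ (μ-reduct<-joinAnts t h) (μ-reduct≤ w s)))
... | inj₂ h =
  ≤-<-trans (μ-conj (reduct w t) (reduct w s)) (s≤s (+-mono-≤-< (μ-reduct≤ w t) (μ-reduct<-joinAnts s h)))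
μ-reduct<-joinAnts {w = w} (t ∨ᵗ s) h with ⊨-∪⁻ {a = joinAnts t} h
... | inj₁ h =
  ≤-<-trans (μ-disj (reduct w t) (reduct w s)) (s≤s (+-mono-<-≤ (μ-reduct<-joinAnts t h) (μ-reduct≤ w s)))
... | inj₂ h =
  ≤-<-trans (μ-disj (reduct w t) (reduct w s)) (s≤s (+-mono-≤-< (μ-reduct≤ w t) (μ-reduct<-joinAnts s h)))

neg-constant : {r : Term n} → Constant r → Constant (neg r)
neg-constant 𝟘 = 𝟙
neg-constant 𝟙 = 𝟘

conj-constant : {r s : Term n} → Constant r → Constant s → Constant (conj r s)
conj-constant 𝟘 _ = 𝟘
conj-constant 𝟙 c = c

disj-constant : {r s : Term n} → Constant r → Constant s → Constant (disj r s)
disj-constant 𝟘 c = c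
disj-constant 𝟙 _ = 𝟙

reduct-constant : (w : Fin n) (t : Term n) → hasCond t ≡ false → Constant (reduct w t)
reduct-constant w (cnd a b p) ()
reduct-constant w 𝟘 h = 𝟘
reduct-constant w 𝟙 h = 𝟙
reduct-constant w (¬ᵗ t) h = neg-constant (reduct-constant w t h)
reduct-constant w (t ∧ᵗ s) h =
  conj-constant (reduct-constant w t (∨-conicalˡ _ _ h)) (reduct-constant w s (∨-conicalʳ _ _ h))
reduct-constant w (t ∨ᵗ s) h =
  disj-constant (reduct-constant w t (∨-conicalˡ _ _ h)) (reduct-constant w s (∨-conicalʳ _ _ h))

μ-reduct< : {t : Term n} → Compound t → w ⊨ 𝐛 t → μ (reduct w t) < μ t
μ-reduct< {t = t} c h with hasCond t in eq
... | true = μ-reduct<-joinAnts t h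
... | false = ≡.subst (_< μ t) (≡.sym (μ-constant (reduct-constant _ t eq))) (μ-compound c)

module Sums {c ℓ ℓ′} (R : CommutativeSemiring c ℓ)
            (_≼_ : Rel (CommutativeSemiring.Carrier R) ℓ′) where

  open CommutativeSemiring R using (Carrier; _≈_; 0#; refl; trans; +-cong; +-identityʳ)

  Σ-cong : ∀ {k} {f g : Fin k → Carrier} → (∀ i → f i ≈ g i) → Σ R _≼_ f ≈ Σ R _≼_ g
  Σ-cong {zero} _ = refl
  Σ-cong {suc k} h = +-cong (h zero) (Σ-cong (h ∘ suc))

  Σ-zero : ∀ {k} {f : Fin k → Carrier} → (∀ i → f i ≈ 0#) → Σ R _≼_ f ≈ 0#
  Σ-zero {zero} _ = refl
  Σ-zero {suc k} h = trans (+-cong (h zero) (Σ-zero (h ∘ suc))) (+-identityʳ 0#)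

  if-cong : ∀ x {a a′ e e′ : Carrier} → (T x → a ≈ a′) → e ≈ e′ →
            (if x then a else e) ≈ (if x then a′ else e′)
  if-cong true  h _ = h _
  if-cong false _ h = h

module Semantics {c ℓ ℓ′} (R : CommutativeSemiring c ℓ)
                 (_≼_ : Rel (CommutativeSemiring.Carrier R) ℓ′)
                 {n : ℕ} (Pr : CondProb R _≼_ n) where

  open CommutativeSemiring R
    using (Carrier; _≈_; _+_; _*_; 0#; 1#; setoid; refl; sym; trans; reflexive
          ; +-cong; *-cong; +-identityʳ; *-identityˡ; zeroˡ)
  open import Relation.Binary.Reasoning.Setoid setoid
  open CondProb Pr using (P; normed; additive)
  open Sums R _≼_

  P-⋃ᶠ : ∀ {k} (A : Fin (suc k) → Subset n) → (∀ {i j} → i ≢ j → Empty (A i ∩ A j)) →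
         ∀ {b} → Nonempty b → Σ R _≼_ (λ i → P (A i) b) ≈ P (⋃ᶠ A) b
  P-⋃ᶠ {zero} A _ _ = +-identityʳ _
  P-⋃ᶠ {suc k} A disjoint {b} nb = begin
    P (A zero) b + Σ R _≼_ (λ i → P (A (suc i)) b) ≈⟨ +-cong refl (P-⋃ᶠ (A ∘ suc) (disjoint ∘ suc-≢) nb) ⟩
    P (A zero) b + P (⋃ᶠ (A ∘ suc)) b              ≈⟨ additive _ _ b nb head-disjoint ⟨
    P (⋃ᶠ A) b                                      ∎
    where
    suc-≢ : ∀ {i j : Fin (suc k)} → i ≢ j → suc i ≢ suc j
    suc-≢ i≢j = i≢j ∘ suc-injective
    head-disjoint : Empty (A zero ∩ ⋃ᶠ (A ∘ suc))
    head-disjoint (x , h) with x∈p∩q⁻ (A zero) _ h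
    ... | h₀ , hₛ with x∈⋃ᶠ⁻ (A ∘ suc) hₛ
    ...   | i , hᵢ = disjoint {zero} {suc i} (λ ()) (x , x∈p∩q⁺ (h₀ , hᵢ))

  -- The two clauses are identical: matching on the witness only serves to expose n = suc m.
  total-probability : ∀ {b} → Nonempty b → Σ R _≼_ (λ v → P ⁅ v ⁆ b) ≈ P ⊤ b
  total-probability {b} nb@(zero , _) =
    trans (P-⋃ᶠ ⁅_⁆ atoms-disjoint nb) (reflexive (≡.cong (λ a → P a b) ⋃ᶠ-atoms))
  total-probability {b} nb@(suc _ , _) =
    trans (P-⋃ᶠ ⁅_⁆ atoms-disjoint nb) (reflexive (≡.cong (λ a → P a b) ⋃ᶠ-atoms))

  𝔼-cong : ∀ {F G : Fin n → Carrier} b → (∀ v → F v ≈ G v) → 𝔼 R _≼_ Pr F b ≈ 𝔼 R _≼_ Pr G b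
  𝔼-cong b h = Σ-cong {n} (λ v → *-cong (h v) refl)

  𝔼-zero : ∀ b → 𝔼 R _≼_ Pr (λ _ → 0#) b ≈ 0#
  𝔼-zero b = Σ-zero {n} (λ v → zeroˡ _)

  𝔼-one : ∀ {b} → Nonempty b → 𝔼 R _≼_ Pr (λ _ → 1#) b ≈ 1#
  𝔼-one {b} nb = begin
    Σ R _≼_ (λ v → 1# * P ⁅ v ⁆ b) ≈⟨ Σ-cong {n} (λ v → *-identityˡ _) ⟩
    Σ R _≼_ (λ v → P ⁅ v ⁆ b)      ≈⟨ total-probability nb ⟩
    P ⊤ b                          ≈⟨ normed b nb ⟩
    1#                             ∎

  extend : Subset n → (Fin n → Carrier) → Fin n → Carrier
  extend b F w = if lookup b w then F w else 𝔼 R _≼_ Pr (λ v → if lookup b v then F v else 0#) b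

  extend-cong : ∀ b {F G : Fin n → Carrier} → (∀ v → v ⊨ b → F v ≈ G v) →
                ∀ w → extend b F w ≈ extend b G w
  extend-cong b h w = if-cong (lookup b w) (h w) (𝔼-cong b (λ v → if-cong (lookup b v) (h v) refl))

  extend-⊨ : ∀ b (F : Fin n → Carrier) {w} → w ⊨ b → extend b F w ≡ F w
  extend-⊨ b F {w} h with lookup b w
  ... | true = ≡.refl

  𝔼X : Term n → Carrier
  𝔼X r = 𝔼 R _≼_ Pr (X R _≼_ Pr r) (𝐛 r)

  Xf-compound : ∀ {t} → Compound t → ∀ k w →
                Xf R _≼_ Pr (suc k) t w ≡ extend (𝐛 t) (inner R _≼_ Pr k t) w
  Xf-compound (cnd a b p) k w = ≡.refl
  Xf-compound (¬ᵗ t) k w = ≡.refl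
  Xf-compound (t ∧ᵗ s) k w = ≡.refl
  Xf-compound (t ∨ᵗ s) k w = ≡.refl

  Xf-stable : ∀ k k′ t → μ t ≤ k → μ t ≤ k′ →
              ∀ w → Xf R _≼_ Pr k t w ≈ Xf R _≼_ Pr k′ t w
  Xf-stable k k′ t p p′ w with constant-or-compound t
  ... | inj₁ 𝟘 = refl
  ... | inj₁ 𝟙 = refl
  Xf-stable zero k′ t p p′ w | inj₂ c = ⊥-elim (n≮0 (<-≤-trans (μ-compound c) p))
  Xf-stable (suc j) zero t p p′ w | inj₂ c = ⊥-elim (n≮0 (<-≤-trans (μ-compound c) p′))
  Xf-stable (suc j) (suc j′) t p p′ w | inj₂ c = begin
    Xf R _≼_ Pr (suc j) t w           ≡⟨ Xf-compound c j w ⟩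
    extend (𝐛 t) (inner R _≼_ Pr j t) w  ≈⟨ extend-cong (𝐛 t) reducts-agree w ⟩
    extend (𝐛 t) (inner R _≼_ Pr j′ t) w ≡⟨ Xf-compound c j′ w ⟨
    Xf R _≼_ Pr (suc j′) t w          ∎
    where
    reducts-agree : ∀ v → v ⊨ 𝐛 t → inner R _≼_ Pr j t v ≈ inner R _≼_ Pr j′ t v
    reducts-agree v h = 𝔼-cong _ (Xf-stable j j′ (reduct v t)
      (≤-pred (<-≤-trans (μ-reduct< c h) p))
      (≤-pred (<-≤-trans (μ-reduct< c h) p′)))

  X-unfold-constant : ∀ {r} → Constant r →
                      ∀ w → X R _≼_ Pr r w ≈ extend (𝐛 r) (λ v → 𝔼X (reduct v r)) w
  X-unfold-constant 𝟘 w = sym (trans (reflexive (extend-⊨ ⊤ _ (⊨⊤ w))) (𝔼-zero ⊤))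
  X-unfold-constant 𝟙 w = sym (trans (reflexive (extend-⊨ ⊤ _ (⊨⊤ w))) (𝔼-one (w , ∈⊤)))

  X-unfold-compound : ∀ {t} → Compound t →
                      ∀ w → X R _≼_ Pr t w ≈ extend (𝐛 t) (λ v → 𝔼X (reduct v t)) w
  X-unfold-compound {t} c w = begin
    X R _≼_ Pr t w                          ≈⟨ Xf-stable (μ t) (suc (μ t)) t ≤-refl (n≤1+n _) w ⟩
    Xf R _≼_ Pr (suc (μ t)) t w             ≡⟨ Xf-compound c (μ t) w ⟩
    extend (𝐛 t) (inner R _≼_ Pr (μ t) t) w ≈⟨ extend-cong (𝐛 t) reducts-agree w ⟩
    extend (𝐛 t) (λ v → 𝔼X (reduct v t)) w  ∎
    where
    reducts-agree : ∀ v → v ⊨ 𝐛 t → inner R _≼_ Pr (μ t) t v ≈ 𝔼X (reduct v t)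
    reducts-agree v _ = 𝔼-cong _ (Xf-stable _ _ (reduct v t) (μ-reduct≤ v t) ≤-refl)

  X-unfold : ∀ t w → X R _≼_ Pr t w ≈ extend (𝐛 t) (λ v → 𝔼X (reduct v t)) w
  X-unfold t w with constant-or-compound t
  ... | inj₁ c = X-unfold-constant c w
  ... | inj₂ c = X-unfold-compound c w

corollary4p2 : ∀ {c ℓ ℓ'} (R : CommutativeSemiring c ℓ)
    (_≤_ : Rel (CommutativeSemiring.Carrier R) ℓ') {n : ℕ}
    (Pr : CondProb R _≤_ n) (t t' : Term n) →
    𝐛 t ≡ 𝐛 t' →
    (∀ (w : Fin n) → w ⊨ 𝐛 t → reduct w t ≡ reduct w t') →
    ∀ (w : Fin n) → CommutativeSemiring._≈_ R (X R _≤_ Pr t w) (X R _≤_ Pr t' w)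
corollary4p2 R _≤_ Pr t t' 𝐛t≡𝐛t' reducts-equal w = begin
  X R _≤_ Pr t w                             ≈⟨ X-unfold t w ⟩
  extend (𝐛 t) (λ v → 𝔼X (reduct v t)) w     ≈⟨ extend-cong (𝐛 t) reducts-agree w ⟩
  extend (𝐛 t) (λ v → 𝔼X (reduct v t')) w    ≡⟨ ≡.cong (λ b → extend b (λ v → 𝔼X (reduct v t')) w) 𝐛t≡𝐛t' ⟩
  extend (𝐛 t') (λ v → 𝔼X (reduct v t')) w   ≈⟨ X-unfold t' w ⟨
  X R _≤_ Pr t' w                            ∎
  where
  open Semantics R _≤_ Pr
  open CommutativeSemiring R using (_≈_; setoid; reflexive)
  open import Relation.Binary.Reasoning.Setoid setoid

  reducts-agree : ∀ v → v ⊨ 𝐛 t → 𝔼X (reduct v t) ≈ 𝔼X (reduct v t')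
  reducts-agree v v⊨ = reflexive (≡.cong 𝔼X (reducts-equal v v⊨))
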